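{- Let $m,n\ge1$, let $B$ be the $m\times n$ board and let $G$ be a crosspatch knight pseudotour on $B$. Let $H$ be the graph whose vertices are all board vertices of $B$ and whose edges are the red board edges (defined below). Then every vertex of $H$ has even degree.
   Context: Square $(i,j)$ of $B$ (column $i\in\{1,\dots,m\}$, row $j\in\{1,\dots,n\}$) is the unit square centred at the point $(i,j)$. Board vertices are the corners of these squares, i.e. the points $(a+\tfrac12,b+\tfrac12)$, $0\le a\le m$, $0\le b\le n$; board edges are the sides of these squares (unit segments between adjacent board vertices). A knight move is the segment joining the centres of two squares differing by $(\pm1,\pm2)$ or $(\pm2,\pm1)$. A knight pseudotour is a graph on the set of squares whose edges are knight moves and in which every vertex has degree $2$. Two knight moves form a cross if their midpoints coincide; $G$ is crosspatch if each of its edges forms a cross with another edge of $G$. For every cross formed by two edges of $G$, the board edge whose midpoint equals the common midpoint of the cross is coloured red. -}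

module Defs where

open import Data.Bool using (Bool; true; false; _∧_; not; T)
open import Data.Nat using (ℕ; zero; suc; _+_; _*_; ∣_-_∣; _≡ᵇ_)
open import Data.Fin using (Fin; toℕ; inject₁) renaming (suc to fsuc)
open import Data.Fin.Properties renaming (_≟_ to _≟F_)
open import Data.Product using (_×_; _,_; proj₁; proj₂; ∃-syntax)
open import Data.Product.Properties using (≡-dec)
open import Data.Bool.ListAction using (any)
open import Data.List using (List; length; filterᵇ; cartesianProduct; map; _++_; allFin)
open import Relation.Nullary using (does)
open import Relation.Binary.PropositionalEquality using (_≡_)

-- Square (i , j): column i ∈ {1..m} is represented by Fin m via i = toℕ i' + 1,
-- row j ∈ {1..n} likewise.
Square : ℕ → ℕ → Set
Square m n = Fin m × Fin n

col : ∀ {m n} → Square m n → ℕ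
col s = suc (toℕ (proj₁ s))

row : ∀ {m n} → Square m n → ℕ
row s = suc (toℕ (proj₂ s))

allSquares : ∀ m n → List (Square m n)
allSquares m n = cartesianProduct (allFin m) (allFin n)

_≟Sq_ : ∀ {m n} (s t : Square m n) → Relation.Nullary.Dec (s ≡ t)
_≟Sq_ = ≡-dec _≟F_ _≟F_

KnightMove : ∀ {m n} → Square m n → Square m n → Set
KnightMove s t =
  (∣ col s - col t ∣ ≡ 1 × ∣ row s - row t ∣ ≡ 2) Data.Sum.⊎
  (∣ col s - col t ∣ ≡ 2 × ∣ row s - row t ∣ ≡ 1)
  where import Data.Sum

record KnightGraph (m n : ℕ) : Set where
  field
    adj    : Square m n → Square m n → Bool
    sym    : ∀ s t → adj s t ≡ adj t s
    knight : ∀ s t → T (adj s t) → KnightMove s t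

open KnightGraph public

degree : ∀ {m n} → KnightGraph m n → Square m n → ℕ
degree {m} {n} G s = length (filterᵇ (adj G s) (allSquares m n))

IsPseudotour : ∀ {m n} → KnightGraph m n → Set
IsPseudotour {m} {n} G = ∀ (s : Square m n) → degree G s ≡ 2

-- Midpoints in doubled coordinates: the midpoint of the segment from the
-- centre of s to the centre of t is ((col s + col t)/2 , (row s + row t)/2);
-- we record (col s + col t , row s + row t).
sameMidᵇ : ∀ {m n} → Square m n → Square m n → Square m n → Square m n → Bool
sameMidᵇ a b c d = ((col a + col b) ≡ᵇ (col c + col d)) ∧ ((row a + row b) ≡ᵇ (row c + row d))

distinctEdgeᵇ : ∀ {m n} → Square m n → Square m n → Square m n → Square m n → Bool
distinctEdgeᵇ a b c d =
  not ((does (a ≟Sq c) ∧ does (b ≟Sq d)) Data.Bool.∨ (does (a ≟Sq d) ∧ does (b ≟Sq c)))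
  where import Data.Bool

crossᵇ : ∀ {m n} → KnightGraph m n → Square m n → Square m n → Square m n → Square m n → Bool
crossᵇ G a b c d = adj G a b ∧ adj G c d ∧ distinctEdgeᵇ a b c d ∧ sameMidᵇ a b c d

IsCrosspatch : ∀ {m n} → KnightGraph m n → Set
IsCrosspatch {m} {n} G =
  ∀ (a b : Square m n) → T (adj G a b) → ∃[ c ] ∃[ d ] T (crossᵇ G a b c d)

-- Board vertices: (a + 1/2 , b + 1/2) with 0 ≤ a ≤ m, 0 ≤ b ≤ n.
BoardVertex : ℕ → ℕ → Set
BoardVertex m n = Fin (suc m) × Fin (suc n)

_≟BV_ : ∀ {m n} (u v : BoardVertex m n) → Relation.Nullary.Dec (u ≡ v)
_≟BV_ = ≡-dec _≟F_ _≟F_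

-- Board edges (unit segments between adjacent board vertices):
-- horiz a b joins (a+1/2, b+1/2) and (a+3/2, b+1/2)   (0 ≤ a < m, 0 ≤ b ≤ n)
-- vert  a b joins (a+1/2, b+1/2) and (a+1/2, b+3/2)   (0 ≤ a ≤ m, 0 ≤ b < n)
data BoardEdge (m n : ℕ) : Set where
  horiz : Fin m → Fin (suc n) → BoardEdge m n
  vert  : Fin (suc m) → Fin n → BoardEdge m n

allBoardEdges : ∀ m n → List (BoardEdge m n)
allBoardEdges m n =
  map (λ p → horiz (proj₁ p) (proj₂ p)) (cartesianProduct (allFin m) (allFin (suc n)))
  ++ map (λ p → vert (proj₁ p) (proj₂ p)) (cartesianProduct (allFin (suc m)) (allFin n))

endpoint₁ endpoint₂ : ∀ {m n} → BoardEdge m n → BoardVertex m n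
endpoint₁ (horiz a b) = inject₁ a , b
endpoint₁ (vert a b)  = a , inject₁ b
endpoint₂ (horiz a b) = fsuc a , b
endpoint₂ (vert a b)  = a , fsuc b

incidentᵇ : ∀ {m n} → BoardVertex m n → BoardEdge m n → Bool
incidentᵇ v e = does (v ≟BV endpoint₁ e) Data.Bool.∨ does (v ≟BV endpoint₂ e)
  where import Data.Bool

-- midpoint of a board edge in doubled coordinates
edgeMidX edgeMidY : ∀ {m n} → BoardEdge m n → ℕ
edgeMidX (horiz a b) = 2 * toℕ a + 2
edgeMidX (vert a b)  = 2 * toℕ a + 1
edgeMidY (horiz a b) = 2 * toℕ b + 1
edgeMidY (vert a b)  = 2 * toℕ b + 2

redᵇ : ∀ {m n} → KnightGraph m n → BoardEdge m n → Bool
redᵇ {m} {n} G e =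
  any (λ ab → any (λ cd →
         crossᵇ G (proj₁ ab) (proj₂ ab) (proj₁ cd) (proj₂ cd)
         ∧ ((col (proj₁ ab) + col (proj₂ ab)) ≡ᵇ edgeMidX e)
         ∧ ((row (proj₁ ab) + row (proj₂ ab)) ≡ᵇ edgeMidY e))
       (cartesianProduct (allSquares m n) (allSquares m n)))
     (cartesianProduct (allSquares m n) (allSquares m n))

degreeH : ∀ {m n} → KnightGraph m n → BoardVertex m n → ℕ
degreeH {m} {n} G v =
  length (filterᵇ (λ e → incidentᵇ v e ∧ redᵇ G e) (allBoardEdges m n))

module Submission where

-- Work modulo 2 and in doubled coordinates, where midpoints of knight moves and of board
-- edges are lattice points.  The degree of a board vertex v in H is the number of red points
-- among the four edge midpoints next to v.  Summing over the four corners of a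
-- square s, the four inner edge midpoints cancel and what remains are the eight knight
-- midpoints of s.  A knight midpoint of s is red exactly when the knight move from s through
-- it is an edge of G: two distinct crossing knight moves occupy all four corners of their
-- bounding box, so one of them starts at s.  Hence the corner sum is the degree of s in G,
-- which is 2.  Since no vertex on the left or bottom side of the board is next to a red point,
-- induction over the vertices shows that every vertex has even degree.

open import Defs hiding (sym)

open import Algebra.Bundles using (CommutativeRing)
open import Data.Bool using (Bool; true; false; _∧_; _∨_; _xor_; not; T)
open import Data.Bool.Properties
  using (T-∧; T-≡; ⇔→≡; ∨-zeroʳ; ∧-zeroʳ; ∧-identityʳ; ∧-distribʳ-∨; ∧-distribˡ-∨; ∧-distribʳ-xor;
         ∧-distribˡ-xor; xor-assoc; xor-identityʳ; xor-annihilates-not; not-involutive; ¬-not;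
         xor-∧-commutativeRing)
open import Data.Empty using (⊥-elim)
open import Data.Fin using (toℕ; fromℕ<; inject₁) renaming (suc to fsuc)
open import Data.Fin.Properties using (toℕ-inject₁; toℕ-injective; toℕ-fromℕ<; toℕ<n)
open import Data.List using (List; []; _∷_; _++_; map; length; filterᵇ; cartesianProduct; allFin)
open import Data.List.Membership.Propositional using (_∈_; lose)
open import Data.List.Membership.Propositional.Properties
  using (∈-++⁻; ∈-++⁺ˡ; ∈-++⁺ʳ; ∈-map⁺; ∈-map⁻; ∈-cartesianProduct⁻; ∈-cartesianProduct⁺; ∈-allFin)
open import Data.List.Relation.Unary.All as All using (All)
open import Data.List.Relation.Unary.Any using (here; there; satisfied)
open import Data.List.Relation.Unary.Any.Properties using (any⁺; any⁻)
open import Data.List.Relation.Unary.Unique.Propositional using (Unique; _∷_)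
open import Data.List.Relation.Unary.Unique.Propositional.Properties
  using (map⁺; ++⁺; cartesianProduct⁺; allFin⁺)
open import Data.Nat using (ℕ; zero; suc; _+_; _*_; _∸_; _≤_; _<_; ∣_-_∣; _≟_; z≤n; s≤s)
open import Data.Nat.Divisibility using (_∣_; divides; ∣-refl; ∣m∣n⇒∣m+n)
open import Data.Nat.Properties
  using (suc-injective; +-suc; +-comm; +-identityʳ; +-cancelˡ-≡; +-cancelʳ-≡; ≤-refl; ≤-reflexive;
         ≤-trans; ≤-<-trans; ≤-total; ≤-pred; <⇒≤; <⇒≢; <⇒≱; m<n+m; m∸n≤m; m+n∸n≡m; m∸[m∸n]≡n;
         m+[n∸m]≡n; m≤n⇒∣m-n∣≡n∸m; m≤n⇒∣n-m∣≡n∸m; ∣m-m+n∣≡n; ∣m+n-m+o∣≡∣n-o∣; ≡ᵇ⇒≡; ≡⇒≡ᵇ)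
open import Data.Nat.Tactic.RingSolver using (solve-∀)
open import Data.Product using (∃; _×_; _,_; proj₁; proj₂; uncurry)
open import Data.Product.Properties using (,-injective)
open import Data.Sum using (_⊎_; inj₁; inj₂; [_,_])
open import Function using (_∘_)
open import Function.Bundles using (Equivalence; mk⇔)
open import Relation.Binary.PropositionalEquality
  using (_≡_; _≢_; refl; sym; trans; cong; cong₂; subst; subst₂; module ≡-Reasoning)
open import Relation.Nullary using (¬_; Dec; does; yes; no)
open import Relation.Nullary.Decidable using (map′; _×-dec_; dec-true; dec-false)

open import Algebra.Properties.CommutativeSemigroup
  (CommutativeRing.+-commutativeSemigroup xor-∧-commutativeRing)
  using () renaming (interchange to xor-interchange)

-- Parity of a predicate along a list

parity : {A : Set} → (A → Bool) → List A → Bool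
parity f []       = false
parity f (x ∷ xs) = f x xor parity f xs

module _ {A : Set} where

  parity-++ : ∀ (f : A → Bool) xs ys → parity f (xs ++ ys) ≡ parity f xs xor parity f ys
  parity-++ f []       ys = refl
  parity-++ f (x ∷ xs) ys = trans (cong (f x xor_) (parity-++ f xs ys)) (sym (xor-assoc (f x) _ _))

  parity-map : ∀ {B : Set} (f : A → Bool) (g : B → A) xs → parity f (map g xs) ≡ parity (f ∘ g) xs
  parity-map f g []       = refl
  parity-map f g (x ∷ xs) = cong (f (g x) xor_) (parity-map f g xs)

  parity-xor : ∀ (f g : A → Bool) xs →
    parity (λ x → f x xor g x) xs ≡ parity f xs xor parity g xs
  parity-xor f g []       = refl
  parity-xor f g (x ∷ xs) =
    trans (cong ((f x xor g x) xor_) (parity-xor f g xs)) (xor-interchange (f x) (g x) _ _)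

  parity-∧ˡ : ∀ b (f : A → Bool) xs → parity (λ x → b ∧ f x) xs ≡ b ∧ parity f xs
  parity-∧ˡ b f []       = sym (∧-zeroʳ b)
  parity-∧ˡ b f (x ∷ xs) =
    trans (cong ((b ∧ f x) xor_) (parity-∧ˡ b f xs)) (sym (∧-distribˡ-xor b (f x) _))

  parity-∧ʳ : ∀ (f : A → Bool) b xs → parity (λ x → f x ∧ b) xs ≡ parity f xs ∧ b
  parity-∧ʳ f b []       = refl
  parity-∧ʳ f b (x ∷ xs) =
    trans (cong ((f x ∧ b) xor_) (parity-∧ʳ f b xs)) (sym (∧-distribʳ-xor b (f x) _))

  parity-cong : ∀ {f g : A → Bool} xs → (∀ {x} → x ∈ xs → f x ≡ g x) → parity f xs ≡ parity g xs
  parity-cong []       eq = refl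
  parity-cong (x ∷ xs) eq = cong₂ _xor_ (eq (here refl)) (parity-cong xs (eq ∘ there))

  parity-false : ∀ {f : A → Bool} xs → (∀ {x} → x ∈ xs → f x ≡ false) → parity f xs ≡ false
  parity-false []       eq = refl
  parity-false (x ∷ xs) eq = cong₂ _xor_ (eq (here refl)) (parity-false xs (eq ∘ there))

  parity-true⇒∃ : ∀ (f : A → Bool) xs → parity f xs ≡ true → ∃ λ x → f x ≡ true
  parity-true⇒∃ f (x ∷ xs) eq with f x in fx
  ... | true  = x , fx
  ... | false = parity-true⇒∃ f xs eq

  parity-single : ∀ {f : A → Bool} {xs s} → Unique xs → s ∈ xs →
                  (∀ x → f x ≡ true → x ≡ s) → parity f xs ≡ f s
  parity-single {f} {s ∷ xs} (s∉xs ∷ _) (here refl) only =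
    trans (cong (f s xor_) (parity-false xs λ x∈xs → ¬-not λ fx → All.lookup s∉xs x∈xs (sym (only _ fx))))
          (xor-identityʳ (f s))
  parity-single {f} {x ∷ _} (x∉xs ∷ u) (there s∈xs) only with f x in fx
  ... | true  = ⊥-elim (All.lookup x∉xs s∈xs (only x fx))
  ... | false = parity-single u s∈xs only

  parity-swap : ∀ {B : Set} (g : A → B → Bool) xs ys →
    parity (λ x → parity (g x) ys) xs ≡ parity (λ y → parity (λ x → g x y) xs) ys
  parity-swap g xs []       = parity-false xs λ _ → refl
  parity-swap g xs (y ∷ ys) =
    trans (parity-xor (λ x → g x y) (λ x → parity (g x) ys) xs)
          (cong (parity (λ x → g x y) xs xor_) (parity-swap g xs ys))

parity-× : ∀ {A B : Set} (f : A → Bool) (g : B → Bool) xs ys →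
  parity (λ p → f (proj₁ p) ∧ g (proj₂ p)) (cartesianProduct xs ys) ≡ parity f xs ∧ parity g ys
parity-× f g []       ys = refl
parity-× {A} {B} f g (x ∷ xs) ys = begin
  parity h (map (x ,_) ys ++ cartesianProduct xs ys)
    ≡⟨ parity-++ h (map (x ,_) ys) (cartesianProduct xs ys) ⟩
  parity h (map (x ,_) ys) xor parity h (cartesianProduct xs ys)
    ≡⟨ cong₂ _xor_ (trans (parity-map h (x ,_) ys) (parity-∧ˡ (f x) g ys)) (parity-× f g xs ys) ⟩
  (f x ∧ parity g ys) xor (parity f xs ∧ parity g ys)
    ≡⟨ ∧-distribʳ-xor (parity g ys) (f x) (parity f xs) ⟨
  (f x xor parity f xs) ∧ parity g ys ∎
  where
  open ≡-Reasoning
  h : A × B → Bool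
  h = λ p → f (proj₁ p) ∧ g (proj₂ p)

-- Boolean identities, decided by truth table

BoolFun : ℕ → Set
BoolFun zero    = Bool
BoolFun (suc k) = Bool → BoolFun k

allTrue : ∀ k → BoolFun k → Bool
allTrue zero    b = b
allTrue (suc k) f = allTrue k (f true) ∧ allTrue k (f false)

Valid : ∀ k → BoolFun k → Set
Valid zero    b = T b
Valid (suc k) f = ∀ x → Valid k (f x)

allTrue-sound : ∀ k (f : BoolFun k) → T (allTrue k f) → Valid k f
allTrue-sound zero    b t       = t
allTrue-sound (suc k) f t true  = allTrue-sound k (f true)  (proj₁ (Equivalence.to T-∧ t))
allTrue-sound (suc k) f t false = allTrue-sound k (f false) (proj₂ (Equivalence.to T-∧ t))

_==_ : Bool → Bool → Bool
a == b = not (a xor b)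

==-sound : ∀ {a b} → T (a == b) → a ≡ b
==-sound {true}  {true}  _ = refl
==-sound {false} {false} _ = refl

-- Recursive rather than n + n, so that the midpoint lists of adjacent corners below coincide
-- definitionally.
double : ℕ → ℕ
double zero    = zero
double (suc n) = suc (suc (double n))

double≡n+n : ∀ n → double n ≡ n + n
double≡n+n zero    = refl
double≡n+n (suc n) = cong suc (trans (cong suc (double≡n+n n)) (sym (+-suc n n)))

double-distrib-+ : ∀ m n → double (m + n) ≡ double m + double n
double-distrib-+ zero    n = refl
double-distrib-+ (suc m) n = cong (suc ∘ suc) (double-distrib-+ m n)

double-injective : ∀ {m n} → double m ≡ double n → m ≡ n
double-injective {zero}  {zero}  _  = refl
double-injective {suc m} {suc n} eq = cong suc (double-injective (suc-injective (suc-injective eq)))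

isOdd : ℕ → Bool
isOdd zero    = false
isOdd (suc n) = not (isOdd n)

isOdd-double : ∀ n → isOdd (double n) ≡ false
isOdd-double zero    = refl
isOdd-double (suc n) = trans (not-involutive _) (isOdd-double n)

isOdd-∣-∣ : ∀ m n → isOdd ∣ m - n ∣ ≡ isOdd m xor isOdd n
isOdd-∣-∣ zero    n       = refl
isOdd-∣-∣ (suc m) zero    = sym (xor-identityʳ _)
isOdd-∣-∣ (suc m) (suc n) = trans (isOdd-∣-∣ m n) (sym (xor-annihilates-not (isOdd m) (isOdd n)))

isOdd-∣double-∣ : ∀ z x → isOdd ∣ double z - x ∣ ≡ isOdd x
isOdd-∣double-∣ z x = trans (isOdd-∣-∣ (double z) x) (cong (_xor isOdd x) (isOdd-double z))

parity≡isOdd-length : ∀ {A : Set} (f : A → Bool) xs → parity f xs ≡ isOdd (length (filterᵇ f xs))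
parity≡isOdd-length f []       = refl
parity≡isOdd-length f (x ∷ xs) with f x
... | true  = cong not (parity≡isOdd-length f xs)
... | false = parity≡isOdd-length f xs

isOdd≡false⇒2∣ : ∀ n → isOdd n ≡ false → 2 ∣ n
isOdd≡false⇒2∣ zero          _ = divides 0 refl
isOdd≡false⇒2∣ (suc zero)    ()
isOdd≡false⇒2∣ (suc (suc n)) e =
  ∣m∣n⇒∣m+n (∣-refl {2}) (isOdd≡false⇒2∣ n (trans (sym (not-involutive _)) e))

double≢1+double : ∀ x y → double x ≢ suc (double y)
double≢1+double x y eq
  with () ← trans (sym (isOdd-double x)) (trans (cong isOdd eq) (cong not (isOdd-double y)))

double-≟ : ∀ x y → does (double x ≟ double y) ≡ does (x ≟ y)
double-≟ zero    zero    = refl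
double-≟ zero    (suc y) = refl
double-≟ (suc x) zero    = refl
double-≟ (suc x) (suc y) = double-≟ x y

2*n+1≡1+double : ∀ x → 2 * x + 1 ≡ suc (double x)
2*n+1≡1+double x =
  trans (+-comm (2 * x) 1) (cong suc (trans (cong (x +_) (+-identityʳ x)) (sym (double≡n+n x))))

2*n+2≡double[1+n] : ∀ x → 2 * x + 2 ≡ double (suc x)
2*n+2≡double[1+n] x =
  trans (+-comm (2 * x) 2) (cong (suc ∘ suc) (trans (cong (x +_) (+-identityʳ x)) (sym (double≡n+n x))))

∣m-n∣≡k⇒ : ∀ {m n k} → ∣ m - n ∣ ≡ k → m ≡ n + k ⊎ n ≡ m + k
∣m-n∣≡k⇒ {m} {n} refl with ≤-total m n
... | inj₁ m≤n = inj₂ (sym (trans (cong (m +_) (m≤n⇒∣m-n∣≡n∸m m≤n)) (m+[n∸m]≡n m≤n)))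
... | inj₂ n≤m = inj₁ (sym (trans (cong (n +_) (m≤n⇒∣n-m∣≡n∸m n≤m)) (m+[n∸m]≡n n≤m)))

reflected : ∀ {u v s d} → u ≡ s + d → s ≡ v + d → u + v ≡ s + s
reflected {v = v} {d = d} refl refl = lemma v d
  where
  lemma : ∀ v d → v + d + d + v ≡ v + d + (v + d)
  lemma = solve-∀

halve : ∀ {x y s} → double x + double y ≡ s + s → x + y ≡ s
halve {x} {y} {s} e = double-injective (trans (double-distrib-+ x y) (trans e (sym (double≡n+n s))))

equidistant : ∀ x y s → ∣ double x - s ∣ ≡ ∣ double y - s ∣ → x ≡ y ⊎ x + y ≡ s
equidistant x y s eq with ∣m-n∣≡k⇒ eq | ∣m-n∣≡k⇒ {double y} {s} refl
... | inj₁ p | inj₁ q = inj₁ (double-injective (trans p (sym q)))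
... | inj₂ p | inj₂ q = inj₁ (double-injective (+-cancelʳ-≡ _ _ _ (trans (sym p) q)))
... | inj₁ p | inj₂ q = inj₂ (halve {x} {y} (reflected p q))
... | inj₂ p | inj₁ q = inj₂ (halve {x} {y} (trans (+-comm (double x) (double y)) (reflected q p)))

equidistant-endpoint : ∀ x a b → ∣ double x - (a + b) ∣ ≡ ∣ double a - (a + b) ∣ → x ≡ a ⊎ x ≡ b
equidistant-endpoint x a b eq with equidistant x a (a + b) eq
... | inj₁ x≡a     = inj₁ x≡a
... | inj₂ x+a≡a+b = inj₂ (+-cancelʳ-≡ a x b (trans x+a≡a+b (+-comm a b)))

∣double[a]-[a+b]∣≡∣a-b∣ : ∀ a b → ∣ double a - (a + b) ∣ ≡ ∣ a - b ∣
∣double[a]-[a+b]∣≡∣a-b∣ a b = trans (cong ∣_- a + b ∣ (double≡n+n a)) (∣m+n-m+o∣≡∣n-o∣ a a b)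

a+[a+k]≡k+double[a] : ∀ a k → a + (a + k) ≡ k + double a
a+[a+k]≡k+double[a] a k = trans (lemma a k) (cong (k +_) (sym (double≡n+n a)))
  where
  lemma : ∀ a k → a + (a + k) ≡ k + (a + a)
  lemma = solve-∀

∣i-j∣≡k⇒sum : ∀ {i j k} → ∣ i - j ∣ ≡ k → ∃ λ u → i + j ≡ k + double u × (k + u ≡ i ⊎ k + u ≡ j)
∣i-j∣≡k⇒sum {i} {j} {k} eq with ∣m-n∣≡k⇒ {i} {j} eq
... | inj₁ refl = j , trans (+-comm (j + k) j) (a+[a+k]≡k+double[a] j k) , inj₁ (+-comm k j)
... | inj₂ refl = i , a+[a+k]≡k+double[a] i k , inj₂ (+-comm k i)

sum-suc : ∀ {i j x} → i + j ≡ x → suc i + suc j ≡ suc (suc x)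
sum-suc {i} {j} eq = cong suc (trans (+-suc i j) (cong suc eq))

larger-below : ∀ {i j x N} → x ≡ i ⊎ x ≡ j → i < N → j < N → x < N
larger-below (inj₁ refl) i<N _   = i<N
larger-below (inj₂ refl) _   j<N = j<N

3≤sum : ∀ {i j} → 1 ≤ ∣ i - j ∣ → 3 ≤ suc i + suc j
3≤sum {zero}  {zero}  ()
3≤sum {zero}  {suc j} _ = s≤s (s≤s (s≤s z≤n))
3≤sum {suc i} {j}     _ = s≤s (s≤s (subst (1 ≤_) (sym (+-suc i j)) (s≤s z≤n)))

partner : ∀ {x y a b} → x + y ≡ a + b → x ≡ a → y ≡ b
partner {x} eq refl = +-cancelˡ-≡ x _ _ eq

partner′ : ∀ {x y a b} → x + y ≡ a + b → x ≡ b → y ≡ a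
partner′ {x} {y} {a} eq refl = partner (trans eq (+-comm a x)) refl

∣double-1+double∣≟1 : ∀ A a → does (∣ double A - suc (double a) ∣ ≟ 1) ≡ does (a ≟ A) ∨ does (suc a ≟ A)
∣double-1+double∣≟1 zero          zero    = refl
∣double-1+double∣≟1 zero          (suc a) = refl
∣double-1+double∣≟1 (suc zero)    zero    = refl
∣double-1+double∣≟1 (suc (suc A)) zero    = refl
∣double-1+double∣≟1 (suc A)       (suc a) = ∣double-1+double∣≟1 A a

around : ℕ → ℕ → List ℕ
around k z = z ∸ k ∷ k + z ∷ []

around⇒∣-∣ : ∀ {k z} → k ≤ z → ∀ {x} → x ∈ around k z → ∣ z - x ∣ ≡ k
around⇒∣-∣ {k} {z} k≤z (here refl)         = trans (m≤n⇒∣n-m∣≡n∸m (m∸n≤m z k)) (m∸[m∸n]≡n k≤z)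
around⇒∣-∣ {k} {z} k≤z (there (here refl)) = trans (cong ∣ z -_∣ (+-comm k z)) (∣m-m+n∣≡n z k)

∣-∣⇒around : ∀ {k z x} → ∣ z - x ∣ ≡ k → x ≡ z ∸ k ⊎ x ≡ k + z
∣-∣⇒around {k} {z} {x} eq with ∣m-n∣≡k⇒ {z} {x} eq
... | inj₁ refl = inj₁ (sym (m+n∸n≡m x k))
... | inj₂ refl = inj₂ (+-comm z k)

parity-around : ∀ {k z} x → 1 ≤ k → k ≤ z →
  parity (λ y → does (x ≟ y)) (around k z) ≡ does (∣ z - x ∣ ≟ k)
parity-around {k} {z} x 1≤k k≤z with x ≟ z ∸ k | x ≟ k + z
... | yes x≡l | yes x≡r = ⊥-elim (<⇒≢ (≤-<-trans (m∸n≤m z k) (m<n+m z 1≤k)) (trans (sym x≡l) x≡r))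
... | yes x≡l | no x≢r  =
  trans (cong₂ (λ a b → a xor (b xor false)) (dec-true (x ≟ _) x≡l) (dec-false (x ≟ _) x≢r))
        (sym (dec-true (_ ≟ k) (around⇒∣-∣ k≤z (here x≡l))))
... | no x≢l  | yes x≡r =
  trans (cong₂ (λ a b → a xor (b xor false)) (dec-false (x ≟ _) x≢l) (dec-true (x ≟ _) x≡r))
        (sym (dec-true (_ ≟ k) (around⇒∣-∣ k≤z (there (here x≡r)))))
... | no x≢l  | no x≢r  =
  trans (cong₂ (λ a b → a xor (b xor false)) (dec-false (x ≟ _) x≢l) (dec-false (x ≟ _) x≢r))
        (sym (dec-false (_ ≟ k) λ eq → [ x≢l , x≢r ] (∣-∣⇒around eq)))

-- Edge midpoints around a board vertex and knight midpoints around a square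

-- Doubled coordinates: the midpoint of squares s and t is (col s + col t , row s + row t), the
-- centre of s is (2 col s , 2 row s), and board vertex (A , B) is (2A + 1 , 2B + 1).
Point : Set
Point = ℕ × ℕ

_≟P_ : (p q : Point) → Dec (p ≡ q)
(x , y) ≟P (x′ , y′) = map′ (uncurry (cong₂ _,_)) ,-injective ((x ≟ x′) ×-dec (y ≟ y′))

≟P-sound : ∀ p q {b} → does (p ≟P q) ∧ b ≡ true → p ≡ q × T b
≟P-sound (x , y) (x′ , y′) eq
  with xy , b ← Equivalence.to T-∧ (Equivalence.from T-≡ eq)
  with x≡ , y≡ ← Equivalence.to T-∧ xy =
  cong₂ _,_ (≡ᵇ⇒≡ x x′ x≡) (≡ᵇ⇒≡ y y′ y≡) , b

vertexMids : Point → List Point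
vertexMids (x , y) = cartesianProduct (around 1 x) (y ∷ []) ++ cartesianProduct (x ∷ []) (around 1 y)

knightMids : Point → List Point
knightMids (x , y) = cartesianProduct (around 2 x) (around 1 y) ++ cartesianProduct (around 1 x) (around 2 y)

corner : ℕ → ℕ → Point
corner A B = suc (double A) , suc (double B)

-- Each inner edge midpoint of the square is next to two of its corners; the eight outer ones are
-- its knight midpoints.
corners-knightMids : ∀ (f : Point → Bool) A B →
  parity f (vertexMids (corner A B)) xor parity f (vertexMids (corner (suc A) B)) xor
  parity f (vertexMids (corner A (suc B))) xor parity f (vertexMids (corner (suc A) (suc B)))
  ≡ parity f (knightMids (double (suc A) , double (suc B)))
corners-knightMids f A B = ==-sound (allTrue-sound 12 identity _
  (f (D , 1 + E)) (f (2 + D , 1 + E)) (f (1 + D , E)) (f (1 + D , 2 + E))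
  (f (4 + D , 1 + E)) (f (3 + D , E)) (f (3 + D , 2 + E)) (f (D , 3 + E))
  (f (2 + D , 3 + E)) (f (1 + D , 4 + E)) (f (4 + D , 3 + E)) (f (3 + D , 4 + E)))
  where
  D E : ℕ
  D = double A
  E = double B
  identity : BoolFun 12
  identity p₁ p₂ p₃ p₄ p₅ p₆ p₇ p₈ p₉ p₁₀ p₁₁ p₁₂ =
    ((p₁ xor (p₂ xor (p₃ xor (p₄ xor false)))) xor ((p₂ xor (p₅ xor (p₆ xor (p₇ xor false)))) xor
     ((p₈ xor (p₉ xor (p₄ xor (p₁₀ xor false)))) xor (p₉ xor (p₁₁ xor (p₇ xor (p₁₂ xor false)))))))
    == (p₁ xor (p₈ xor (p₅ xor (p₁₁ xor (p₃ xor (p₁₀ xor (p₆ xor (p₁₂ xor false))))))))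

KnightOffset : ℕ → ℕ → Set
KnightOffset dx dy = (dx ≡ 1 × dy ≡ 2) ⊎ (dx ≡ 2 × dy ≡ 1)

KnightMidpoint : Point → Point → Set
KnightMidpoint (z , w) (x , y) = KnightOffset ∣ z - x ∣ ∣ w - y ∣

same-knightOffset : ∀ {dx dy dx′ dy′} → KnightOffset dx dy → KnightOffset dx′ dy′ →
                    isOdd dx ≡ isOdd dx′ → dx ≡ dx′ × dy ≡ dy′
same-knightOffset (inj₁ (refl , refl)) (inj₁ (refl , refl)) _  = refl , refl
same-knightOffset (inj₂ (refl , refl)) (inj₂ (refl , refl)) _  = refl , refl
same-knightOffset (inj₁ (refl , refl)) (inj₂ (refl , refl)) ()
same-knightOffset (inj₂ (refl , refl)) (inj₁ (refl , refl)) ()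

knightOffset-test : ∀ {dx dy} → KnightOffset dx dy →
  (does (dx ≟ 2) ∧ does (dy ≟ 1)) xor (does (dx ≟ 1) ∧ does (dy ≟ 2)) ≡ true
knightOffset-test (inj₁ (refl , refl)) = refl
knightOffset-test (inj₂ (refl , refl)) = refl

parity-knightMids : ∀ {z w} q → 2 ≤ z → 2 ≤ w → KnightMidpoint (z , w) q →
  parity (λ p → does (q ≟P p)) (knightMids (z , w)) ≡ true
parity-knightMids {z} {w} (x , y) 2≤z 2≤w offset = begin
  parity eq? (cartesianProduct (around 2 z) (around 1 w) ++ cartesianProduct (around 1 z) (around 2 w))
    ≡⟨ parity-++ eq? (cartesianProduct (around 2 z) (around 1 w)) (cartesianProduct (around 1 z) (around 2 w)) ⟩
  parity eq? (cartesianProduct (around 2 z) (around 1 w)) xor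
  parity eq? (cartesianProduct (around 1 z) (around 2 w))
    ≡⟨ cong₂ _xor_ (parity-× (does ∘ (x ≟_)) (does ∘ (y ≟_)) (around 2 z) (around 1 w))
                   (parity-× (does ∘ (x ≟_)) (does ∘ (y ≟_)) (around 1 z) (around 2 w)) ⟩
  (parity (does ∘ (x ≟_)) (around 2 z) ∧ parity (does ∘ (y ≟_)) (around 1 w)) xor
  (parity (does ∘ (x ≟_)) (around 1 z) ∧ parity (does ∘ (y ≟_)) (around 2 w))
    ≡⟨ cong₂ _xor_ (cong₂ _∧_ (parity-around x 1≤2 2≤z) (parity-around y ≤-refl 1≤w))
                   (cong₂ _∧_ (parity-around x ≤-refl 1≤z) (parity-around y 1≤2 2≤w)) ⟩
  (does (∣ z - x ∣ ≟ 2) ∧ does (∣ w - y ∣ ≟ 1)) xor (does (∣ z - x ∣ ≟ 1) ∧ does (∣ w - y ∣ ≟ 2))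
    ≡⟨ knightOffset-test offset ⟩
  true ∎
  where
  open ≡-Reasoning
  eq? : Point → Bool
  eq? p = does ((x , y) ≟P p)
  1≤2 : 1 ≤ 2
  1≤2 = s≤s z≤n
  1≤z : 1 ≤ z
  1≤z = ≤-trans 1≤2 2≤z
  1≤w : 1 ≤ w
  1≤w = ≤-trans 1≤2 2≤w

∈-knightMids : ∀ {z w p} → 2 ≤ z → 2 ≤ w → p ∈ knightMids (z , w) → KnightMidpoint (z , w) p
∈-knightMids {z} {w} 2≤z 2≤w p∈ with ∈-++⁻ (cartesianProduct (around 2 z) (around 1 w)) p∈
... | inj₁ p∈₂₁ with x∈ , y∈ ← ∈-cartesianProduct⁻ (around 2 z) (around 1 w) p∈₂₁ =
  inj₂ (around⇒∣-∣ 2≤z x∈ , around⇒∣-∣ (≤-trans (s≤s z≤n) 2≤w) y∈)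
... | inj₂ p∈₁₂ with x∈ , y∈ ← ∈-cartesianProduct⁻ (around 1 z) (around 2 w) p∈₁₂ =
  inj₁ (around⇒∣-∣ (≤-trans (s≤s z≤n) 2≤z) x∈ , around⇒∣-∣ 2≤w y∈)

parity-vertexMids : ∀ {x y} q → 1 ≤ x → 1 ≤ y →
  parity (λ p → does (q ≟P p)) (vertexMids (x , y))
    ≡ (does (∣ x - proj₁ q ∣ ≟ 1) ∧ does (proj₂ q ≟ y)) xor (does (proj₁ q ≟ x) ∧ does (∣ y - proj₂ q ∣ ≟ 1))
parity-vertexMids {x} {y} (X , Y) 1≤x 1≤y = begin
  parity eq? (cartesianProduct (around 1 x) (y ∷ []) ++ cartesianProduct (x ∷ []) (around 1 y))
    ≡⟨ parity-++ eq? (cartesianProduct (around 1 x) (y ∷ [])) (cartesianProduct (x ∷ []) (around 1 y)) ⟩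
  parity eq? (cartesianProduct (around 1 x) (y ∷ [])) xor parity eq? (cartesianProduct (x ∷ []) (around 1 y))
    ≡⟨ cong₂ _xor_ (parity-× (does ∘ (X ≟_)) (does ∘ (Y ≟_)) (around 1 x) (y ∷ []))
                   (parity-× (does ∘ (X ≟_)) (does ∘ (Y ≟_)) (x ∷ []) (around 1 y)) ⟩
  (parity (does ∘ (X ≟_)) (around 1 x) ∧ (does (Y ≟ y) xor false)) xor
  ((does (X ≟ x) xor false) ∧ parity (does ∘ (Y ≟_)) (around 1 y))
    ≡⟨ cong₂ _xor_ (cong₂ _∧_ (parity-around X ≤-refl 1≤x) (xor-identityʳ _))
                   (cong₂ _∧_ (xor-identityʳ _) (parity-around Y ≤-refl 1≤y)) ⟩
  (does (∣ x - X ∣ ≟ 1) ∧ does (Y ≟ y)) xor (does (X ≟ x) ∧ does (∣ y - Y ∣ ≟ 1)) ∎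
  where
  open ≡-Reasoning
  eq? : Point → Bool
  eq? p = does ((X , Y) ≟P p)

module _ {m n : ℕ} where

  mid : Square m n → Square m n → Point
  mid s t = col s + col t , row s + row t

  centre : Square m n → Point
  centre s = double (col s) , double (row s)

  edgeMid : BoardEdge m n → Point
  edgeMid e = edgeMidX e , edgeMidY e

  vertexPoint : BoardVertex m n → Point
  vertexPoint (a , b) = corner (toℕ a) (toℕ b)

  SameEdge : Square m n → Square m n → Square m n → Square m n → Set
  SameEdge a b c d = (a ≡ c × b ≡ d) ⊎ (a ≡ d × b ≡ c)

  square-≡ : ∀ {s t : Square m n} → col s ≡ col t → row s ≡ row t → s ≡ t
  square-≡ c r = cong₂ _,_ (toℕ-injective (suc-injective c)) (toℕ-injective (suc-injective r))

  mid-injectiveʳ : ∀ {s t t′ : Square m n} → mid s t ≡ mid s t′ → t ≡ t′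
  mid-injectiveʳ {s} eq with c , r ← ,-injective eq =
    square-≡ (+-cancelˡ-≡ (col s) _ _ c) (+-cancelˡ-≡ (row s) _ _ r)

  knight-KnightMidpoint : ∀ {s t : Square m n} → KnightMove s t → KnightMidpoint (centre s) (mid s t)
  knight-KnightMidpoint {s} {t} =
    subst₂ KnightOffset (sym (∣double[a]-[a+b]∣≡∣a-b∣ (col s) (col t)))
                        (sym (∣double[a]-[a+b]∣≡∣a-b∣ (row s) (row t)))

  knight-endpoints : ∀ {a b s : Square m n} → KnightMove a b → KnightMidpoint (centre s) (mid a b) →
    (col s ≡ col a ⊎ col s ≡ col b) × (row s ≡ row a ⊎ row s ≡ row b)
  knight-endpoints {a} {b} {s} ab sab
    with dx , dy ← same-knightOffset sab (knight-KnightMidpoint {a} {b} ab)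
                     (trans (isOdd-∣double-∣ (col s) (col a + col b))
                            (sym (isOdd-∣double-∣ (col a) (col a + col b)))) =
    equidistant-endpoint (col s) (col a) (col b) dx , equidistant-endpoint (row s) (row a) (row b) dy

  crossing-partner : ∀ {a b a′ b′ : Square m n} → KnightMove a b → KnightMove a′ b′ →
    mid a′ b′ ≡ mid a b → ¬ SameEdge a b a′ b′ →
    (a′ ≡ (proj₁ a , proj₂ b) × b′ ≡ (proj₁ b , proj₂ a)) ⊎
    (a′ ≡ (proj₁ b , proj₂ a) × b′ ≡ (proj₁ a , proj₂ b))
  crossing-partner {a} {b} {a′} {b′} ab a′b′ eq ¬same
    with cs , rs ← ,-injective eq
    with knight-endpoints {a} {b} {a′} ab
           (subst (KnightMidpoint (centre a′)) eq (knight-KnightMidpoint {a′} {b′} a′b′))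
  ... | inj₁ c , inj₁ r =
    ⊥-elim (¬same (inj₁ (sym (square-≡ c r) , sym (square-≡ (partner cs c) (partner rs r)))))
  ... | inj₂ c , inj₂ r =
    ⊥-elim (¬same (inj₂ (sym (square-≡ (partner′ cs c) (partner′ rs r)) , sym (square-≡ c r))))
  ... | inj₁ c , inj₂ r = inj₁ (square-≡ c r , square-≡ (partner cs c) (partner′ rs r))
  ... | inj₂ c , inj₁ r = inj₂ (square-≡ c r , square-≡ (partner′ cs c) (partner rs r))

  cross-covers : ∀ {a b a′ b′ s : Square m n} → KnightMove a b → KnightMove a′ b′ →
    mid a′ b′ ≡ mid a b → ¬ SameEdge a b a′ b′ → KnightMidpoint (centre s) (mid a b) →
    ∃ λ t → SameEdge s t a b ⊎ SameEdge s t a′ b′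
  cross-covers {a} {b} {a′} {b′} {s} ab a′b′ eq ¬same sab
    with knight-endpoints {a} {b} {s} ab sab | crossing-partner ab a′b′ eq ¬same
  ... | inj₁ c , inj₁ r | _              = b  , inj₁ (inj₁ (square-≡ c r , refl))
  ... | inj₂ c , inj₂ r | _              = a  , inj₁ (inj₂ (square-≡ c r , refl))
  ... | inj₁ c , inj₂ r | inj₁ (a′≡ , _) = b′ , inj₂ (inj₁ (trans (square-≡ c r) (sym a′≡) , refl))
  ... | inj₁ c , inj₂ r | inj₂ (_ , b′≡) = a′ , inj₂ (inj₂ (trans (square-≡ c r) (sym b′≡) , refl))
  ... | inj₂ c , inj₁ r | inj₁ (_ , b′≡) = a′ , inj₂ (inj₂ (trans (square-≡ c r) (sym b′≡) , refl))
  ... | inj₂ c , inj₁ r | inj₂ (a′≡ , _) = b′ , inj₂ (inj₁ (trans (square-≡ c r) (sym a′≡) , refl))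

  edgeMid-horiz : ∀ a b → edgeMid (horiz a b) ≡ (double (suc (toℕ a)) , suc (double (toℕ b)))
  edgeMid-horiz a b = cong₂ _,_ (2*n+2≡double[1+n] (toℕ a)) (2*n+1≡1+double (toℕ b))

  edgeMid-vert : ∀ a b → edgeMid (vert a b) ≡ (suc (double (toℕ a)) , double (suc (toℕ b)))
  edgeMid-vert a b = cong₂ _,_ (2*n+1≡1+double (toℕ a)) (2*n+2≡double[1+n] (toℕ b))

  edgeMid-injective : ∀ {e e′ : BoardEdge m n} → edgeMid e ≡ edgeMid e′ → e ≡ e′
  edgeMid-injective {horiz a b} {horiz a′ b′} eq
    with x , y ← ,-injective (trans (sym (edgeMid-horiz a b)) (trans eq (edgeMid-horiz a′ b′))) =
    cong₂ horiz (toℕ-injective (suc-injective (double-injective x)))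
                (toℕ-injective (double-injective (suc-injective y)))
  edgeMid-injective {horiz a b} {vert a′ b′} eq
    with x , _ ← ,-injective (trans (sym (edgeMid-horiz a b)) (trans eq (edgeMid-vert a′ b′))) =
    ⊥-elim (double≢1+double _ _ x)
  edgeMid-injective {vert a b} {horiz a′ b′} eq
    with x , _ ← ,-injective (trans (sym (edgeMid-vert a b)) (trans eq (edgeMid-horiz a′ b′))) =
    ⊥-elim (double≢1+double _ _ (sym x))
  edgeMid-injective {vert a b} {vert a′ b′} eq
    with x , y ← ,-injective (trans (sym (edgeMid-vert a b)) (trans eq (edgeMid-vert a′ b′))) =
    cong₂ vert (toℕ-injective (double-injective (suc-injective x)))
               (toℕ-injective (suc-injective (double-injective y)))

  knight-edge : ∀ {s t : Square m n} → KnightMove s t → ∃ λ e → edgeMid e ≡ mid s t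
  knight-edge {s} {t} (inj₁ (dx , dy))
    with u , cs , u+1 ← ∣i-j∣≡k⇒sum {toℕ (proj₁ s)} {toℕ (proj₁ t)} dx
       | w , rs , w+2 ← ∣i-j∣≡k⇒sum {toℕ (proj₂ s)} {toℕ (proj₂ t)} dy =
    vert (fromℕ< u<) (fromℕ< w<) ,
    trans (edgeMid-vert _ _) (cong₂ _,_ (trans (cong (suc ∘ double) (toℕ-fromℕ< u<)) (sym (sum-suc cs)))
                                        (trans (cong (double ∘ suc) (toℕ-fromℕ< w<)) (sym (sum-suc rs))))
    where
    u< : suc u < suc m
    u< = s≤s (<⇒≤ (larger-below u+1 (toℕ<n (proj₁ s)) (toℕ<n (proj₁ t))))
    w< : suc w < n
    w< = <⇒≤ (larger-below w+2 (toℕ<n (proj₂ s)) (toℕ<n (proj₂ t)))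
  knight-edge {s} {t} (inj₂ (dx , dy))
    with u , cs , u+2 ← ∣i-j∣≡k⇒sum {toℕ (proj₁ s)} {toℕ (proj₁ t)} dx
       | w , rs , w+1 ← ∣i-j∣≡k⇒sum {toℕ (proj₂ s)} {toℕ (proj₂ t)} dy =
    horiz (fromℕ< u<) (fromℕ< w<) ,
    trans (edgeMid-horiz _ _) (cong₂ _,_ (trans (cong (double ∘ suc) (toℕ-fromℕ< u<)) (sym (sum-suc cs)))
                                         (trans (cong (suc ∘ double) (toℕ-fromℕ< w<)) (sym (sum-suc rs))))
    where
    u< : suc u < m
    u< = <⇒≤ (larger-below u+2 (toℕ<n (proj₁ s)) (toℕ<n (proj₁ t)))
    w< : suc w < suc n
    w< = s≤s (<⇒≤ (larger-below w+1 (toℕ<n (proj₂ s)) (toℕ<n (proj₂ t))))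

  3≤knight-mid : ∀ {s t : Square m n} → KnightMove s t → 3 ≤ col s + col t × 3 ≤ row s + row t
  3≤knight-mid (inj₁ (dx , dy)) = 3≤sum (≤-reflexive (sym dx)) , 3≤sum (subst (1 ≤_) (sym dy) (s≤s z≤n))
  3≤knight-mid (inj₂ (dx , dy)) = 3≤sum (subst (1 ≤_) (sym dx) (s≤s z≤n)) , 3≤sum (≤-reflexive (sym dy))

  does-≟BV : ∀ (v w : BoardVertex m n) →
    does (v ≟BV w) ≡ does (toℕ (proj₁ w) ≟ toℕ (proj₁ v)) ∧ does (toℕ (proj₂ w) ≟ toℕ (proj₂ v))
  does-≟BV v w with v ≟BV w
  ... | yes refl = sym (cong₂ _∧_ (dec-true (toℕ (proj₁ v) ≟ _) refl) (dec-true (toℕ (proj₂ v) ≟ _) refl))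
  ... | no v≢w with toℕ (proj₁ w) ≟ toℕ (proj₁ v) | toℕ (proj₂ w) ≟ toℕ (proj₂ v)
  ...   | yes p | yes q = ⊥-elim (v≢w (sym (cong₂ _,_ (toℕ-injective p) (toℕ-injective q))))
  ...   | yes p | no ¬q = sym (cong₂ _∧_ (dec-true (_ ≟ _) p) (dec-false (_ ≟ _) ¬q))
  ...   | no ¬p | _     = sym (cong (_∧ does (toℕ (proj₂ w) ≟ toℕ (proj₂ v))) (dec-false (_ ≟ _) ¬p))

  incident-horiz : ∀ (v : BoardVertex m n) a b →
    incidentᵇ v (horiz a b) ≡ parity (λ p → does (edgeMid (horiz a b) ≟P p)) (vertexMids (vertexPoint v))
  incident-horiz v a b = begin
    does (v ≟BV (inject₁ a , b)) ∨ does (v ≟BV (fsuc a , b))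
      ≡⟨ cong₂ _∨_ (does-≟BV v (inject₁ a , b)) (does-≟BV v (fsuc a , b)) ⟩
    (does (toℕ (inject₁ a) ≟ A) ∧ does (β ≟ B)) ∨ (does (suc α ≟ A) ∧ does (β ≟ B))
      ≡⟨ cong (λ i → (does (i ≟ A) ∧ does (β ≟ B)) ∨ (does (suc α ≟ A) ∧ does (β ≟ B))) (toℕ-inject₁ a) ⟩
    (does (α ≟ A) ∧ does (β ≟ B)) ∨ (does (suc α ≟ A) ∧ does (β ≟ B))
      ≡⟨ ∧-distribʳ-∨ (does (β ≟ B)) (does (α ≟ A)) (does (suc α ≟ A)) ⟨
    (does (α ≟ A) ∨ does (suc α ≟ A)) ∧ does (β ≟ B)
      ≡⟨ cong₂ _∧_ (∣double-1+double∣≟1 A α) (double-≟ β B) ⟨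
    does (∣ x - X ∣ ≟ 1) ∧ does (Y ≟ y)
      ≡⟨ xor-identityʳ _ ⟨
    (does (∣ x - X ∣ ≟ 1) ∧ does (Y ≟ y)) xor false
      ≡⟨ cong (λ b → (does (∣ x - X ∣ ≟ 1) ∧ does (Y ≟ y)) xor (b ∧ does (∣ y - Y ∣ ≟ 1)))
              (dec-false (X ≟ x) (double≢1+double (suc α) A)) ⟨
    (does (∣ x - X ∣ ≟ 1) ∧ does (Y ≟ y)) xor (does (X ≟ x) ∧ does (∣ y - Y ∣ ≟ 1))
      ≡⟨ parity-vertexMids {x} {y} (X , Y) (s≤s z≤n) (s≤s z≤n) ⟨
    parity (λ p → does ((X , Y) ≟P p)) (vertexMids (x , y))
      ≡⟨ cong (λ q → parity (λ p → does (q ≟P p)) (vertexMids (x , y))) (edgeMid-horiz a b) ⟨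
    parity (λ p → does (edgeMid (horiz a b) ≟P p)) (vertexMids (vertexPoint v)) ∎
    where
    open ≡-Reasoning
    A B α β x y X Y : ℕ
    A = toℕ (proj₁ v)
    B = toℕ (proj₂ v)
    α = toℕ a
    β = toℕ b
    x = suc (double A)
    y = suc (double B)
    X = double (suc α)
    Y = suc (double β)

  incident-vert : ∀ (v : BoardVertex m n) a b →
    incidentᵇ v (vert a b) ≡ parity (λ p → does (edgeMid (vert a b) ≟P p)) (vertexMids (vertexPoint v))
  incident-vert v a b = begin
    does (v ≟BV (a , inject₁ b)) ∨ does (v ≟BV (a , fsuc b))
      ≡⟨ cong₂ _∨_ (does-≟BV v (a , inject₁ b)) (does-≟BV v (a , fsuc b)) ⟩
    (does (α ≟ A) ∧ does (toℕ (inject₁ b) ≟ B)) ∨ (does (α ≟ A) ∧ does (suc β ≟ B))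
      ≡⟨ cong (λ j → (does (α ≟ A) ∧ does (j ≟ B)) ∨ (does (α ≟ A) ∧ does (suc β ≟ B))) (toℕ-inject₁ b) ⟩
    (does (α ≟ A) ∧ does (β ≟ B)) ∨ (does (α ≟ A) ∧ does (suc β ≟ B))
      ≡⟨ ∧-distribˡ-∨ (does (α ≟ A)) (does (β ≟ B)) (does (suc β ≟ B)) ⟨
    does (α ≟ A) ∧ (does (β ≟ B) ∨ does (suc β ≟ B))
      ≡⟨ cong₂ _∧_ (double-≟ α A) (∣double-1+double∣≟1 B β) ⟨
    does (X ≟ x) ∧ does (∣ y - Y ∣ ≟ 1)
      ≡⟨ cong (_xor (does (X ≟ x) ∧ does (∣ y - Y ∣ ≟ 1))) (∧-zeroʳ (does (∣ x - X ∣ ≟ 1))) ⟨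
    (does (∣ x - X ∣ ≟ 1) ∧ false) xor (does (X ≟ x) ∧ does (∣ y - Y ∣ ≟ 1))
      ≡⟨ cong (λ b → (does (∣ x - X ∣ ≟ 1) ∧ b) xor (does (X ≟ x) ∧ does (∣ y - Y ∣ ≟ 1)))
              (dec-false (Y ≟ y) (double≢1+double (suc β) B)) ⟨
    (does (∣ x - X ∣ ≟ 1) ∧ does (Y ≟ y)) xor (does (X ≟ x) ∧ does (∣ y - Y ∣ ≟ 1))
      ≡⟨ parity-vertexMids {x} {y} (X , Y) (s≤s z≤n) (s≤s z≤n) ⟨
    parity (λ p → does ((X , Y) ≟P p)) (vertexMids (x , y))
      ≡⟨ cong (λ q → parity (λ p → does (q ≟P p)) (vertexMids (x , y))) (edgeMid-vert a b) ⟨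
    parity (λ p → does (edgeMid (vert a b) ≟P p)) (vertexMids (vertexPoint v)) ∎
    where
    open ≡-Reasoning
    A B α β x y X Y : ℕ
    A = toℕ (proj₁ v)
    B = toℕ (proj₂ v)
    α = toℕ a
    β = toℕ b
    x = suc (double A)
    y = suc (double B)
    X = suc (double α)
    Y = double (suc β)

  incident-parity : ∀ (v : BoardVertex m n) e →
    incidentᵇ v e ≡ parity (λ p → does (edgeMid e ≟P p)) (vertexMids (vertexPoint v))
  incident-parity v (horiz a b) = incident-horiz v a b
  incident-parity v (vert a b)  = incident-vert v a b

  allSquares-unique : Unique (allSquares m n)
  allSquares-unique = cartesianProduct⁺ (allFin⁺ m) (allFin⁺ n)

  ∈-allSquares : ∀ (s : Square m n) → s ∈ allSquares m n
  ∈-allSquares (a , b) = ∈-cartesianProduct⁺ (∈-allFin a) (∈-allFin b)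

  allBoardEdges-unique : Unique (allBoardEdges m n)
  allBoardEdges-unique =
    ++⁺ (map⁺ horiz-injective (cartesianProduct⁺ (allFin⁺ m) (allFin⁺ (suc n))))
        (map⁺ vert-injective (cartesianProduct⁺ (allFin⁺ (suc m)) (allFin⁺ n)))
        horiz∉verts
    where
    horiz-injective : ∀ {p q} → horiz {m} {n} (proj₁ p) (proj₂ p) ≡ horiz (proj₁ q) (proj₂ q) → p ≡ q
    horiz-injective refl = refl
    vert-injective : ∀ {p q} → vert {m} {n} (proj₁ p) (proj₂ p) ≡ vert (proj₁ q) (proj₂ q) → p ≡ q
    vert-injective refl = refl
    horiz∉verts : ∀ {e} →
      ¬ (e ∈ map (λ p → horiz (proj₁ p) (proj₂ p)) (cartesianProduct (allFin m) (allFin (suc n))) ×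
         e ∈ map (λ p → vert (proj₁ p) (proj₂ p)) (cartesianProduct (allFin (suc m)) (allFin n)))
    horiz∉verts (e∈hs , e∈vs)
      with _ , _ , refl ← ∈-map⁻ (λ p → horiz (proj₁ p) (proj₂ p)) e∈hs
         | _ , _ , ()   ← ∈-map⁻ (λ p → vert (proj₁ p) (proj₂ p)) e∈vs

  ∈-allBoardEdges : ∀ (e : BoardEdge m n) → e ∈ allBoardEdges m n
  ∈-allBoardEdges (horiz a b) = ∈-++⁺ˡ (∈-map⁺ _ (∈-cartesianProduct⁺ (∈-allFin a) (∈-allFin b)))
  ∈-allBoardEdges (vert a b)  = ∈-++⁺ʳ _ (∈-map⁺ _ (∈-cartesianProduct⁺ (∈-allFin a) (∈-allFin b)))

-- Red board edges of a crosspatch pseudotour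

module _ {m n : ℕ} (G : KnightGraph m n) where

  record Cross (a b c d : Square m n) : Set where
    field
      edge₁    : T (adj G a b)
      edge₂    : T (adj G c d)
      distinct : ¬ SameEdge a b c d
      sameMid  : mid c d ≡ mid a b

  ≟Sq-refl² : ∀ (a b : Square m n) → does (a ≟Sq a) ∧ does (b ≟Sq b) ≡ true
  ≟Sq-refl² a b = cong₂ _∧_ (dec-true (a ≟Sq a) refl) (dec-true (b ≟Sq b) refl)

  distinctEdgeᵇ-sound : ∀ {a b c d : Square m n} → T (distinctEdgeᵇ a b c d) → ¬ SameEdge a b c d
  distinctEdgeᵇ-sound {a} {b} t (inj₁ (refl , refl)) =
    subst (T ∘ not) (cong (_∨ (does (a ≟Sq b) ∧ does (b ≟Sq a))) (≟Sq-refl² a b)) t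
  distinctEdgeᵇ-sound {a} {b} t (inj₂ (refl , refl)) =
    subst (T ∘ not) (trans (cong ((does (a ≟Sq b) ∧ does (b ≟Sq a)) ∨_) (≟Sq-refl² a b)) (∨-zeroʳ _)) t

  crossᵇ-sound : ∀ {a b c d} → T (crossᵇ G a b c d) → Cross a b c d
  crossᵇ-sound {a} {b} {c} {d} t
    with ab , t₁ ← Equivalence.to T-∧ t
    with cd , t₂ ← Equivalence.to T-∧ t₁
    with dist , same ← Equivalence.to T-∧ t₂
    with x , y ← Equivalence.to T-∧ same =
    record { edge₁ = ab ; edge₂ = cd ; distinct = distinctEdgeᵇ-sound dist
           ; sameMid = sym (cong₂ _,_ (≡ᵇ⇒≡ _ _ x) (≡ᵇ⇒≡ _ _ y)) }

  pairs : List (Square m n × Square m n)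
  pairs = cartesianProduct (allSquares m n) (allSquares m n)

  CrossAt : Point → Set
  CrossAt p = ∃ λ a → ∃ λ b → ∃ λ c → ∃ λ d → Cross a b c d × mid a b ≡ p

  red-sound : ∀ e → T (redᵇ G e) → CrossAt (edgeMid e)
  red-sound e t
    with (a , b) , t₁ ← satisfied (any⁻ _ pairs t)
    with (c , d) , t₂ ← satisfied (any⁻ _ pairs t₁)
    with cross , t₃ ← Equivalence.to T-∧ t₂
    with x , y ← Equivalence.to T-∧ t₃ =
    a , b , c , d , crossᵇ-sound cross , cong₂ _,_ (≡ᵇ⇒≡ _ _ x) (≡ᵇ⇒≡ _ _ y)

  red-complete : ∀ {a b c d} e → T (crossᵇ G a b c d) → edgeMid e ≡ mid a b → T (redᵇ G e)
  red-complete {a} {b} {c} {d} e cross eq =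
    any⁺ _ (lose (∈-cartesianProduct⁺ (∈-allSquares a) (∈-allSquares b))
      (any⁺ _ (lose (∈-cartesianProduct⁺ (∈-allSquares c) (∈-allSquares d))
        (Equivalence.from T-∧ (cross , Equivalence.from T-∧ (≡⇒≡ᵇ _ _ (sym x) , ≡⇒≡ᵇ _ _ (sym y)))))))
    where
    x = proj₁ (,-injective eq)
    y = proj₂ (,-injective eq)

  -- Board edges are determined by their midpoints, so this says whether the board edge at p is red.
  redAt : Point → Bool
  redAt p = parity (λ e → does (edgeMid e ≟P p) ∧ redᵇ G e) (allBoardEdges m n)

  neighbourAt : Square m n → Point → Bool
  neighbourAt s p = parity (λ t → does (mid s t ≟P p) ∧ adj G s t) (allSquares m n)

  redAt-true⇒cross : ∀ {p} → redAt p ≡ true → CrossAt p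
  redAt-true⇒cross {p} r = subst CrossAt (proj₁ tests) (red-sound e (proj₂ tests))
    where
    found : ∃ λ e → does (edgeMid e ≟P p) ∧ redᵇ G e ≡ true
    found = parity-true⇒∃ (λ e → does (edgeMid e ≟P p) ∧ redᵇ G e) (allBoardEdges m n) r
    e : BoardEdge m n
    e = proj₁ found
    tests : edgeMid e ≡ p × T (redᵇ G e)
    tests = ≟P-sound (edgeMid e) p (proj₂ found)

  cross⇒redAt : ∀ {a b c d} → T (crossᵇ G a b c d) → redAt (mid a b) ≡ true
  cross⇒redAt {a} {b} cross with e , e≡ab ← knight-edge (knight G a b (Cross.edge₁ (crossᵇ-sound cross))) =
    trans (parity-single allBoardEdges-unique (∈-allBoardEdges e) only)
          (cong₂ _∧_ (dec-true (edgeMid e ≟P mid a b) e≡ab) (Equivalence.to T-≡ (red-complete e cross e≡ab)))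
    where
    only : ∀ e′ → does (edgeMid e′ ≟P mid a b) ∧ redᵇ G e′ ≡ true → e′ ≡ e
    only e′ h = edgeMid-injective (trans (proj₁ (≟P-sound (edgeMid e′) (mid a b) h)) (sym e≡ab))

  EdgeAt : Square m n → Point → Set
  EdgeAt s p = ∃ λ t → mid s t ≡ p × T (adj G s t)

  neighbourAt-true⇒ : ∀ {s p} → neighbourAt s p ≡ true → EdgeAt s p
  neighbourAt-true⇒ {s} {p} r = t , ≟P-sound (mid s t) p (proj₂ found)
    where
    found : ∃ λ t → does (mid s t ≟P p) ∧ adj G s t ≡ true
    found = parity-true⇒∃ (λ t → does (mid s t ≟P p) ∧ adj G s t) (allSquares m n) r
    t : Square m n
    t = proj₁ found

  adj⇒neighbourAt : ∀ {s t} → T (adj G s t) → neighbourAt s (mid s t) ≡ true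
  adj⇒neighbourAt {s} {t} st =
    trans (parity-single allSquares-unique (∈-allSquares t) only)
          (cong₂ _∧_ (dec-true (mid s t ≟P mid s t) refl) (Equivalence.to T-≡ st))
    where
    only : ∀ t′ → does (mid s t′ ≟P mid s t) ∧ adj G s t′ ≡ true → t′ ≡ t
    only t′ h = mid-injectiveʳ {s = s} (proj₁ (≟P-sound (mid s t′) (mid s t) h))

  sameEdge-adj : ∀ {s t a b} → SameEdge s t a b → T (adj G a b) → T (adj G s t)
  sameEdge-adj         (inj₁ (refl , refl)) ab = ab
  sameEdge-adj {a = a} {b} (inj₂ (refl , refl)) ab = subst T (KnightGraph.sym G a b) ab

  sameEdge-mid : ∀ {s t a b : Square m n} → SameEdge s t a b → mid s t ≡ mid a b
  sameEdge-mid         (inj₁ (refl , refl)) = refl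
  sameEdge-mid {a = a} {b} (inj₂ (refl , refl)) = cong₂ _,_ (+-comm (col b) (col a)) (+-comm (row b) (row a))

  sameEdge⇒neighbourAt : ∀ {s t a b p} → SameEdge s t a b → T (adj G a b) → mid a b ≡ p →
                         neighbourAt s p ≡ true
  sameEdge⇒neighbourAt {s} same ab ab≡p =
    subst (λ q → neighbourAt s q ≡ true) (trans (sameEdge-mid same) ab≡p)
          (adj⇒neighbourAt (sameEdge-adj same ab))

  crossAt⇒neighbourAt : ∀ {s p} → KnightMidpoint (centre s) p → CrossAt p → neighbourAt s p ≡ true
  crossAt⇒neighbourAt {s} {p} sp (a , b , c , d , cross , ab≡p) =
    covered (cross-covers (knight G a b edge₁) (knight G c d edge₂) sameMid distinct
                          (subst (KnightMidpoint (centre s)) (sym ab≡p) sp))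
    where
    open Cross cross
    covered : (∃ λ t → SameEdge s t a b ⊎ SameEdge s t c d) → neighbourAt s p ≡ true
    covered (_ , inj₁ same) = sameEdge⇒neighbourAt {p = p} same edge₁ ab≡p
    covered (_ , inj₂ same) = sameEdge⇒neighbourAt {p = p} same edge₂ (trans sameMid ab≡p)

  edgeAt⇒redAt : IsCrosspatch G → ∀ {s p} → EdgeAt s p → redAt p ≡ true
  edgeAt⇒redAt crosspatch {s} (t , refl , st) = cross⇒redAt (proj₂ (proj₂ (crosspatch s t st)))

  redAt≡neighbourAt : IsCrosspatch G → ∀ {s p} → KnightMidpoint (centre s) p → redAt p ≡ neighbourAt s p
  redAt≡neighbourAt crosspatch sp =
    ⇔→≡ (mk⇔ (crossAt⇒neighbourAt sp ∘ redAt-true⇒cross) (edgeAt⇒redAt crosspatch ∘ neighbourAt-true⇒))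

  redAt-low : ∀ {p} → proj₁ p ≤ 2 ⊎ proj₂ p ≤ 2 → redAt p ≡ false
  redAt-low low = ¬-not λ r → away (redAt-true⇒cross r) low
    where
    away : ∀ {p} → CrossAt p → ¬ (proj₁ p ≤ 2 ⊎ proj₂ p ≤ 2)
    away (a , b , _ , _ , cross , refl) (inj₁ x≤2) =
      <⇒≱ (proj₁ (3≤knight-mid {s = a} {t = b} (knight G a b (Cross.edge₁ cross)))) x≤2
    away (a , b , _ , _ , cross , refl) (inj₂ y≤2) =
      <⇒≱ (proj₂ (3≤knight-mid {s = a} {t = b} (knight G a b (Cross.edge₁ cross)))) y≤2

  knightMids-redAt : IsCrosspatch G → ∀ s →
                     parity redAt (knightMids (centre s)) ≡ parity (adj G s) (allSquares m n)
  knightMids-redAt crosspatch s = begin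
    parity redAt (knightMids (centre s))
      ≡⟨ parity-cong (knightMids (centre s))
                     (λ {p} p∈ → redAt≡neighbourAt crosspatch {s} {p} (∈-knightMids 2≤ 2≤ p∈)) ⟩
    parity (neighbourAt s) (knightMids (centre s))
      ≡⟨ parity-swap (λ p t → does (mid s t ≟P p) ∧ adj G s t) (knightMids (centre s)) (allSquares m n) ⟩
    parity (λ t → parity (λ p → does (mid s t ≟P p) ∧ adj G s t) (knightMids (centre s))) (allSquares m n)
      ≡⟨ parity-cong (allSquares m n)
                     (λ {t} _ → parity-∧ʳ (λ p → does (mid s t ≟P p)) (adj G s t) (knightMids (centre s))) ⟩
    parity (λ t → parity (λ p → does (mid s t ≟P p)) (knightMids (centre s)) ∧ adj G s t) (allSquares m n)
      ≡⟨ parity-cong (allSquares m n) (λ {t} _ → exactly-once t) ⟩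
    parity (adj G s) (allSquares m n) ∎
    where
    open ≡-Reasoning
    2≤ : ∀ {x} → 2 ≤ double (suc x)
    2≤ = s≤s (s≤s z≤n)
    exactly-once : ∀ t → parity (λ p → does (mid s t ≟P p)) (knightMids (centre s)) ∧ adj G s t ≡ adj G s t
    exactly-once t with adj G s t in st
    ... | false = ∧-zeroʳ _
    ... | true  = trans (∧-identityʳ _) (parity-knightMids (mid s t) 2≤ 2≤
                    (knight-KnightMidpoint {s = s} {t = t} (knight G s t (subst T (sym st) _))))

  incident-red-parity : ∀ v → parity (λ e → incidentᵇ v e ∧ redᵇ G e) (allBoardEdges m n)
                            ≡ parity redAt (vertexMids (vertexPoint v))
  incident-red-parity v = begin
    parity (λ e → incidentᵇ v e ∧ redᵇ G e) (allBoardEdges m n)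
      ≡⟨ parity-cong (allBoardEdges m n) (λ {e} _ → cong (_∧ redᵇ G e) (incident-parity v e)) ⟩
    parity (λ e → parity (λ p → does (edgeMid e ≟P p)) mids ∧ redᵇ G e) (allBoardEdges m n)
      ≡⟨ parity-cong (allBoardEdges m n)
                     (λ {e} _ → parity-∧ʳ (λ p → does (edgeMid e ≟P p)) (redᵇ G e) mids) ⟨
    parity (λ e → parity (λ p → does (edgeMid e ≟P p) ∧ redᵇ G e) mids) (allBoardEdges m n)
      ≡⟨ parity-swap (λ e p → does (edgeMid e ≟P p) ∧ redᵇ G e) (allBoardEdges m n) mids ⟩
    parity redAt mids ∎
    where
    open ≡-Reasoning
    mids : List Point
    mids = vertexMids (vertexPoint v)

  cornerParity : ℕ → ℕ → Bool
  cornerParity A B = parity redAt (vertexMids (corner A B))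

  adj-parity : IsPseudotour G → ∀ s → parity (adj G s) (allSquares m n) ≡ false
  adj-parity pseudotour s = trans (parity≡isOdd-length (adj G s) (allSquares m n)) (cong isOdd (pseudotour s))

  square-parity : IsPseudotour G → IsCrosspatch G → ∀ {A B} (A<m : A < m) (B<n : B < n) →
    parity redAt (knightMids (double (suc A) , double (suc B))) ≡ false
  square-parity pseudotour crosspatch A<m B<n =
    subst₂ (λ i j → parity redAt (knightMids (double (suc i) , double (suc j))) ≡ false)
           (toℕ-fromℕ< A<m) (toℕ-fromℕ< B<n)
           (trans (knightMids-redAt crosspatch s) (adj-parity pseudotour s))
    where
    s : Square m n
    s = fromℕ< A<m , fromℕ< B<n

  cornerParity≡false : IsPseudotour G → IsCrosspatch G → ∀ A B → A ≤ m → B ≤ n → cornerParity A B ≡ false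
  cornerParity≡false _ _ zero B _ _ = parity-false {f = redAt} (vertexMids (corner zero B)) λ
    { (here refl) → redAt-low (inj₁ z≤n)
    ; (there (here refl)) → redAt-low (inj₁ ≤-refl)
    ; (there (there (here refl))) → redAt-low (inj₁ (s≤s z≤n))
    ; (there (there (there (here refl)))) → redAt-low (inj₁ (s≤s z≤n)) }
  cornerParity≡false _ _ (suc A) zero _ _ = parity-false {f = redAt} (vertexMids (corner (suc A) zero)) λ
    { (here refl) → redAt-low (inj₂ (s≤s z≤n))
    ; (there (here refl)) → redAt-low (inj₂ (s≤s z≤n))
    ; (there (there (here refl))) → redAt-low (inj₂ z≤n)
    ; (there (there (there (here refl)))) → redAt-low (inj₂ ≤-refl) }
  cornerParity≡false pseudotour crosspatch (suc A) (suc B) A<m B<n =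
    last-of-four (cornerParity≡false pseudotour crosspatch A B (<⇒≤ A<m) (<⇒≤ B<n))
                 (cornerParity≡false pseudotour crosspatch (suc A) B A<m (<⇒≤ B<n))
                 (cornerParity≡false pseudotour crosspatch A (suc B) (<⇒≤ A<m) B<n)
                 (trans (corners-knightMids redAt A B) (square-parity pseudotour crosspatch A<m B<n))
    where
    last-of-four : ∀ {a b c d} → a ≡ false → b ≡ false → c ≡ false → a xor b xor c xor d ≡ false → d ≡ false
    last-of-four refl refl refl abcd = abcd

  incident-red-parity≡false : IsPseudotour G → IsCrosspatch G → ∀ v →
    parity (λ e → incidentᵇ v e ∧ redᵇ G e) (allBoardEdges m n) ≡ false
  incident-red-parity≡false pseudotour crosspatch v =
    trans (incident-red-parity v)
          (cornerParity≡false pseudotour crosspatch (toℕ (proj₁ v)) (toℕ (proj₂ v))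
                              (≤-pred (toℕ<n (proj₁ v))) (≤-pred (toℕ<n (proj₂ v))))

lemma1 : ∀ (m n : ℕ) → 1 ≤ m → 1 ≤ n → (G : KnightGraph m n) →
    IsPseudotour G → IsCrosspatch G →
    ∀ (v : BoardVertex m n) → 2 ∣ degreeH G v
lemma1 m n _ _ G pseudotour crosspatch v =
  isOdd≡false⇒2∣ (degreeH G v)
    (trans (sym (parity≡isOdd-length (λ e → incidentᵇ v e ∧ redᵇ G e) (allBoardEdges m n)))
           (incident-red-parity≡false G pseudotour crosspatch v))
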